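{- For every positive integer $n$, $P_{n+1}(x)=-xP_n(-x)+P_{n-1}(x)$.
   Context: For $n\in\mathbb{N}$, $P_n(x)=\sum_{k=0}^{n}(-1)^{\lfloor 3k/2\rfloor}\binom{\lfloor (n+k)/2\rfloor}{k}x^k$ (so $P_0=1$). -}

module Defs where

open import Data.Nat using (ℕ; zero; suc; _+_; _*_; _≤ᵇ_; _/_)
open import Data.Nat.Combinatorics using (_C_)
open import Data.Integer using (ℤ; +_; -_) renaming (_*_ to _*ℤ_)
open import Data.Bool using (if_then_else_)

-- Polynomials with integer coefficients are represented by their
-- coefficient sequence: a polynomial p is a function ℕ → ℤ, with p k the
-- coefficient of x^k.  (Only finitely many nonzero entries for the P_n.)

sgn : ℕ → ℤ
sgn zero = + 1
sgn (suc m) = - sgn m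

P : ℕ → ℕ → ℤ
P n k = if k ≤ᵇ n then sgn ((3 * k) / 2) *ℤ (+ (((n + k) / 2) C k)) else + 0

-- Coefficient sequence of the polynomial  -x · p(-x)
negXSub : (ℕ → ℤ) → ℕ → ℤ
negXSub p zero = + 0
negXSub p (suc j) = - (sgn j *ℤ p j)

-- Write P n k = sign k · magnitude n k, where sign k = (-1)^⌊3k/2⌋ and
-- magnitude n k = C(⌊(n+k)/2⌋, k); the guard k ≤ n in P is redundant because the
-- binomial coefficient already vanishes for k > n.  Comparing coefficients of
-- x^(k+1), the recursion splits into Pascal's rule for m = ⌊(n+k+1)/2⌋,
-- C(m+1, k+1) = C(m, k) + C(m, k+1), and the sign identity
-- sign (k+1) = -(-1)^k sign k, which follows by two-step induction from
-- sign (k+2) = -sign k.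
module Submission where

open import Defs
open import Data.Nat as ℕ using (ℕ; zero; suc; _<_; _>_; _≤ᵇ_)
import Data.Nat.Properties as ℕ
open import Data.Nat.Divisibility using (divides-refl)
open import Data.Nat.DivMod using (_/_; +-distrib-/-∣ˡ; m<n*o⇒m/o<n)
open import Data.Nat.Combinatorics using (_C_; nCk+nC[k+1]≡[n+1]C[k+1])
open import Data.Nat.Combinatorics.Specification using (k>n⇒nCk≡0)
open import Data.Integer using (ℤ; +_; -_; _+_; _*_)
open import Data.Integer.Properties using (neg-involutive; neg-distribˡ-*; neg-distribʳ-*; *-assoc; *-distribˡ-+; *-zeroʳ; pos-+)
open import Data.Bool using (true; false; T)
open import Relation.Binary.PropositionalEquality using (_≡_; refl; sym; trans; cong; cong₂; subst)
open Relation.Binary.PropositionalEquality.≡-Reasoning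

sign : ℕ → ℤ
sign k = sgn ((3 ℕ.* k) / 2)

magnitude : ℕ → ℕ → ℕ
magnitude n k = ((n ℕ.+ k) / 2) C k

[2+m]/2≡1+m/2 : ∀ m → (2 ℕ.+ m) / 2 ≡ suc (m / 2)
[2+m]/2≡1+m/2 m = +-distrib-/-∣ˡ m {2} (divides-refl 1)

3[2+k]/2≡3+3k/2 : ∀ k → (3 ℕ.* (2 ℕ.+ k)) / 2 ≡ 3 ℕ.+ (3 ℕ.* k) / 2
3[2+k]/2≡3+3k/2 k = trans (cong (_/ 2) (ℕ.*-distribˡ-+ 3 2 k)) (+-distrib-/-∣ˡ (3 ℕ.* k) {2} (divides-refl 3))

sgn-2+ : ∀ m → sgn (2 ℕ.+ m) ≡ sgn m
sgn-2+ m = neg-involutive (sgn m)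

sign-2+ : ∀ k → sign (2 ℕ.+ k) ≡ - sign k
sign-2+ k = trans (cong sgn (3[2+k]/2≡3+3k/2 k)) (cong -_ (neg-involutive (sign k)))

sign-suc : ∀ k → sign (suc k) ≡ - (sgn k * sign k)
sign-suc zero = refl
sign-suc (suc zero) = refl
sign-suc (suc (suc k)) = begin
  sign (2 ℕ.+ suc k)                 ≡⟨ sign-2+ (suc k) ⟩
  - sign (suc k)                     ≡⟨ cong -_ (sign-suc k) ⟩
  - - (sgn k * sign k)               ≡⟨ cong -_ (neg-distribʳ-* (sgn k) (sign k)) ⟩
  - (sgn k * - sign k)               ≡⟨ cong₂ (λ a b → - (a * b)) (sym (sgn-2+ k)) (sym (sign-2+ k)) ⟩
  - (sgn (2 ℕ.+ k) * sign (2 ℕ.+ k)) ∎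

magnitude-pascal : ∀ n k →
  magnitude (2 ℕ.+ n) (suc k) ≡ magnitude (suc n) k ℕ.+ magnitude n (suc k)
magnitude-pascal n k = begin
  ((2 ℕ.+ (n ℕ.+ suc k)) / 2) C suc k         ≡⟨ cong (_C suc k) ([2+m]/2≡1+m/2 (n ℕ.+ suc k)) ⟩
  suc m C suc k                               ≡⟨ sym (nCk+nC[k+1]≡[n+1]C[k+1] m k) ⟩
  m C k ℕ.+ m C suc k                         ≡⟨ cong (λ i → (i / 2) C k ℕ.+ m C suc k) (ℕ.+-suc n k) ⟩
  magnitude (suc n) k ℕ.+ magnitude n (suc k) ∎
  where
  m : ℕ
  m = (n ℕ.+ suc k) / 2

magnitude-vanishes : ∀ {n k} → k > n → magnitude n k ≡ 0
magnitude-vanishes {n} {k} k>n = k>n⇒nCk≡0 ⌊[n+k]/2⌋<k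
  where
  k+k≡k*2 : k ℕ.+ k ≡ k ℕ.* 2
  k+k≡k*2 = trans (cong (k ℕ.+_) (sym (ℕ.+-identityʳ k))) (ℕ.*-comm 2 k)
  ⌊[n+k]/2⌋<k : (n ℕ.+ k) / 2 < k
  ⌊[n+k]/2⌋<k = m<n*o⇒m/o<n (subst (n ℕ.+ k <_) k+k≡k*2 (ℕ.+-monoˡ-< k k>n))

P≡sign*magnitude : ∀ n k → P n k ≡ sign k * + magnitude n k
P≡sign*magnitude n k with k ≤ᵇ n in k≤ᵇn
... | true = refl
... | false = begin
  + 0                      ≡⟨ sym (*-zeroʳ (sign k)) ⟩
  sign k * + 0             ≡⟨ cong (λ b → sign k * + b) (sym (magnitude-vanishes k>n)) ⟩
  sign k * + magnitude n k ∎
  where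
  k>n : k > n
  k>n = ℕ.≰⇒> (λ k≤n → subst T k≤ᵇn (ℕ.≤⇒≤ᵇ k≤n))

lemma4p16 : (n : ℕ) → (k : ℕ) →
    P (suc (suc n)) k ≡ negXSub (P (suc n)) k + P n k
lemma4p16 n zero = refl
lemma4p16 n (suc k) = begin
  P (2 ℕ.+ n) (suc k)                                   ≡⟨ P≡sign*magnitude (2 ℕ.+ n) (suc k) ⟩
  s * + magnitude (2 ℕ.+ n) (suc k)                     ≡⟨ cong (λ b → s * + b) (magnitude-pascal n k) ⟩
  s * + (magnitude (suc n) k ℕ.+ magnitude n (suc k))   ≡⟨ cong (s *_) (pos-+ (magnitude (suc n) k) _) ⟩
  s * (+ magnitude (suc n) k + + magnitude n (suc k))   ≡⟨ *-distribˡ-+ s _ _ ⟩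
  s * + magnitude (suc n) k + s * + magnitude n (suc k) ≡⟨ cong₂ _+_ reflected-term (sym (P≡sign*magnitude n (suc k))) ⟩
  - (sgn k * P (suc n) k) + P n (suc k)                 ∎
  where
  s : ℤ
  s = sign (suc k)
  reflected-term : s * + magnitude (suc n) k ≡ - (sgn k * P (suc n) k)
  reflected-term = begin
    s * + magnitude (suc n) k                    ≡⟨ cong (_* + magnitude (suc n) k) (sign-suc k) ⟩
    - (sgn k * sign k) * + magnitude (suc n) k   ≡⟨ sym (neg-distribˡ-* (sgn k * sign k) _) ⟩
    - (sgn k * sign k * + magnitude (suc n) k)   ≡⟨ cong -_ (*-assoc (sgn k) (sign k) _) ⟩
    - (sgn k * (sign k * + magnitude (suc n) k)) ≡⟨ cong (λ p → - (sgn k * p)) (sym (P≡sign*magnitude (suc n) k)) ⟩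
    - (sgn k * P (suc n) k)                      ∎
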